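{- Let $\{A_n\}_{n\ge0}$ be defined by $A_0=A_1=1$ and $(n+1)A_{n+1}=2(n+1)A_n+3(n-1)A_{n-1}$ for $n\ge1$ (the number of directed animals of size $n$). Then $\{A_n\}_{n\ge0}$ is log-convex.
   Context: A sequence $\{z_n\}$ of positive numbers is log-convex if $z_{k-1}z_{k+1}\ge z_k^2$ for all $k\ge1$. -}

module Defs where

open import Data.Nat using (ℕ; suc; _+_; _*_; _≤_; _>_)
open import Data.Product using (_×_)
open import Relation.Binary.PropositionalEquality using (_≡_)

LogConvex : (ℕ → ℕ) → Set
LogConvex z = (∀ n → z n > 0) × (∀ m → z (suc m) * z (suc m) ≤ z m * z (suc (suc m)))

IsDirectedAnimalSeq : (ℕ → ℕ) → Set
IsDirectedAnimalSeq A =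
  (A 0 ≡ 1) × (A 1 ≡ 1) ×
  (∀ m → (suc (suc m)) * A (suc (suc m)) ≡ 2 * (suc (suc m)) * A (suc m) + 3 * m * A m)

-- Write r m = A (m + 1) / A m.  The recurrence reads r (m + 1) = 2 + 3 m / ((m + 2) r m), a
-- decreasing function of r m, so the two-sided bound 6 m / (2 m + 1) ≤ r m ≤ 6 (m + 1) / (2 m + 3)
-- propagates from each index to the next, the lower bound of one step giving the upper bound of the
-- next and vice versa.  Log-convexity at m is r m ≤ r (m + 1), i.e. (m + 2) r² ≤ 2 (m + 2) r + 3 m
-- for r = r m, which holds because 6 (m + 1) / (2 m + 3) lies below the positive root of this quadratic.
-- All ratios are cleared of denominators, so every step is an inequality between naturals.
module Submission where

open import Defs
open import Data.Nat using (ℕ; zero; suc; _+_; _*_; _≤_; _<_; z≤n; s≤s)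
open import Data.Nat.Properties
open import Data.Product using (_×_; _,_; proj₁; proj₂)
open import Relation.Binary.PropositionalEquality using (_≡_; sym; trans; cong)
open import Data.Nat.Tactic.RingSolver using (solve-∀)
open import Algebra.Properties.CommutativeSemigroup *-commutativeSemigroup using (x∙yz≈y∙xz)

RecurrenceStep : ℕ → ℕ → ℕ → ℕ → Set
RecurrenceStep m u v w = (2 + m) * w ≡ 2 * (2 + m) * v + 3 * m * u

RatioLowerBound : ℕ → ℕ → ℕ → Set
RatioLowerBound m u v = 6 * m * u ≤ (1 + 2 * m) * v

RatioUpperBound : ℕ → ℕ → ℕ → Set
RatioUpperBound m u v = (3 + 2 * m) * v ≤ (6 + 6 * m) * u

positive-step : ∀ {m u v w} → RecurrenceStep m u v w → 0 < v → 0 < w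
positive-step {w = suc _} _ _ = s≤s z≤n
positive-step {m} {v = suc _} {w = zero} step _ with trans (sym (*-zeroʳ (2 + m))) step
... | ()

-- 6 (m + 1) / (2 m + 3) ≤ 3 (2 m + 3) / (2 m + 4), since (6 m + 6) (2 m + 4) + 3 = 3 (2 m + 3)².
ratioUpperBound⇒coarse : ∀ m u v → RatioUpperBound m u v → 2 * (2 + m) * v ≤ 3 * (3 + 2 * m) * u
ratioUpperBound⇒coarse m u v upper = *-cancelˡ-≤ (3 + 2 * m) (begin
  (3 + 2 * m) * (2 * (2 + m) * v)          ≡⟨ reorder m v ⟩
  2 * (2 + m) * ((3 + 2 * m) * v)          ≤⟨ *-monoʳ-≤ (2 * (2 + m)) upper ⟩
  2 * (2 + m) * ((6 + 6 * m) * u)          ≤⟨ m≤m+n _ (3 * u) ⟩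
  2 * (2 + m) * ((6 + 6 * m) * u) + 3 * u  ≡⟨ square-identity m u ⟩
  (3 + 2 * m) * (3 * (3 + 2 * m) * u)      ∎)
  where
  open ≤-Reasoning
  reorder : ∀ m v → (3 + 2 * m) * (2 * (2 + m) * v) ≡ 2 * (2 + m) * ((3 + 2 * m) * v)
  reorder = solve-∀
  square-identity : ∀ m u → 2 * (2 + m) * ((6 + 6 * m) * u) + 3 * u ≡ (3 + 2 * m) * (3 * (3 + 2 * m) * u)
  square-identity = solve-∀

ratioLowerBound-step : ∀ m u v w → RecurrenceStep m u v w → RatioUpperBound m u v → RatioLowerBound (suc m) v w
ratioLowerBound-step m u v w step upper = *-cancelˡ-≤ (2 + m) (begin
  (2 + m) * (6 * (1 + m) * v)                               ≡⟨ split m v ⟩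
  2 * (2 + m) * (3 + 2 * m) * v + m * (2 * (2 + m) * v)     ≤⟨ +-monoʳ-≤ (2 * (2 + m) * (3 + 2 * m) * v) (*-monoʳ-≤ m coarse) ⟩
  2 * (2 + m) * (3 + 2 * m) * v + m * (3 * (3 + 2 * m) * u) ≡⟨ factor m u v ⟩
  (3 + 2 * m) * (2 * (2 + m) * v + 3 * m * u)               ≡⟨ cong ((3 + 2 * m) *_) (sym step) ⟩
  (3 + 2 * m) * ((2 + m) * w)                               ≡⟨ reorder m w ⟩
  (2 + m) * ((1 + 2 * (1 + m)) * w)                         ∎)
  where
  open ≤-Reasoning
  coarse : 2 * (2 + m) * v ≤ 3 * (3 + 2 * m) * u
  coarse = ratioUpperBound⇒coarse m u v upper
  split : ∀ m v → (2 + m) * (6 * (1 + m) * v) ≡ 2 * (2 + m) * (3 + 2 * m) * v + m * (2 * (2 + m) * v)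
  split = solve-∀
  factor : ∀ m u v → 2 * (2 + m) * (3 + 2 * m) * v + m * (3 * (3 + 2 * m) * u) ≡ (3 + 2 * m) * (2 * (2 + m) * v + 3 * m * u)
  factor = solve-∀
  reorder : ∀ m w → (3 + 2 * m) * ((2 + m) * w) ≡ (2 + m) * ((1 + 2 * (1 + m)) * w)
  reorder = solve-∀

ratioUpperBound-step : ∀ m u v w → RecurrenceStep m u v w → RatioLowerBound m u v → RatioUpperBound (suc m) v w
ratioUpperBound-step m u v w step lower = *-cancelˡ-≤ (4 + 2 * m) (begin
  (4 + 2 * m) * ((3 + 2 * (1 + m)) * w)                                       ≡⟨ reorder m w ⟩
  2 * (5 + 2 * m) * ((2 + m) * w)                                             ≡⟨ cong (2 * (5 + 2 * m) *_) step ⟩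
  2 * (5 + 2 * m) * (2 * (2 + m) * v + 3 * m * u)                             ≡⟨ expand m u v ⟩
  4 * (5 + 2 * m) * (2 + m) * v + (5 + 2 * m) * (6 * m * u)                   ≤⟨ +-monoʳ-≤ (4 * (5 + 2 * m) * (2 + m) * v) (*-monoʳ-≤ (5 + 2 * m) lower) ⟩
  4 * (5 + 2 * m) * (2 + m) * v + (5 + 2 * m) * ((1 + 2 * m) * v)             ≤⟨ m≤m+n _ (3 * v) ⟩
  4 * (5 + 2 * m) * (2 + m) * v + (5 + 2 * m) * ((1 + 2 * m) * v) + 3 * v     ≡⟨ collect m v ⟩
  (4 + 2 * m) * ((6 + 6 * (1 + m)) * v)                                       ∎)
  where
  open ≤-Reasoning
  reorder : ∀ m w → (4 + 2 * m) * ((3 + 2 * (1 + m)) * w) ≡ 2 * (5 + 2 * m) * ((2 + m) * w)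
  reorder = solve-∀
  expand : ∀ m u v → 2 * (5 + 2 * m) * (2 * (2 + m) * v + 3 * m * u) ≡ 4 * (5 + 2 * m) * (2 + m) * v + (5 + 2 * m) * (6 * m * u)
  expand = solve-∀
  collect : ∀ m v → 4 * (5 + 2 * m) * (2 + m) * v + (5 + 2 * m) * ((1 + 2 * m) * v) + 3 * v ≡ (4 + 2 * m) * ((6 + 6 * (1 + m)) * v)
  collect = solve-∀

log-convex-step : ∀ m u v w → RecurrenceStep m u v w → RatioUpperBound m u v → v * v ≤ u * w
log-convex-step m u v w step upper = *-cancelˡ-≤ (2 + m) (*-cancelˡ-≤ (3 + 2 * m) (begin
  (3 + 2 * m) * ((2 + m) * (v * v))                                   ≡⟨ reorder m v ⟩
  (2 + m) * v * ((3 + 2 * m) * v)                                     ≤⟨ *-monoʳ-≤ ((2 + m) * v) upper ⟩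
  (2 + m) * v * ((6 + 6 * m) * u)                                     ≡⟨ split m u v ⟩
  (3 + 2 * m) * (2 * (2 + m) * u * v) + m * u * (2 * (2 + m) * v)     ≤⟨ +-monoʳ-≤ ((3 + 2 * m) * (2 * (2 + m) * u * v)) (*-monoʳ-≤ (m * u) coarse) ⟩
  (3 + 2 * m) * (2 * (2 + m) * u * v) + m * u * (3 * (3 + 2 * m) * u) ≡⟨ factor m u v ⟩
  (3 + 2 * m) * (u * (2 * (2 + m) * v + 3 * m * u))                   ≡⟨ cong (λ t → (3 + 2 * m) * (u * t)) (sym step) ⟩
  (3 + 2 * m) * (u * ((2 + m) * w))                                   ≡⟨ cong ((3 + 2 * m) *_) (x∙yz≈y∙xz u (2 + m) w) ⟩
  (3 + 2 * m) * ((2 + m) * (u * w))                                   ∎))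
  where
  open ≤-Reasoning
  coarse : 2 * (2 + m) * v ≤ 3 * (3 + 2 * m) * u
  coarse = ratioUpperBound⇒coarse m u v upper
  reorder : ∀ m v → (3 + 2 * m) * ((2 + m) * (v * v)) ≡ (2 + m) * v * ((3 + 2 * m) * v)
  reorder = solve-∀
  split : ∀ m u v → (2 + m) * v * ((6 + 6 * m) * u) ≡ (3 + 2 * m) * (2 * (2 + m) * u * v) + m * u * (2 * (2 + m) * v)
  split = solve-∀
  factor : ∀ m u v → (3 + 2 * m) * (2 * (2 + m) * u * v) + m * u * (3 * (3 + 2 * m) * u) ≡ (3 + 2 * m) * (u * (2 * (2 + m) * v + 3 * m * u))
  factor = solve-∀

module DirectedAnimals (A : ℕ → ℕ) (isDirectedAnimalSeq : IsDirectedAnimalSeq A) where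

  A₀≡1 : A 0 ≡ 1
  A₀≡1 = proj₁ isDirectedAnimalSeq

  A₁≡1 : A 1 ≡ 1
  A₁≡1 = proj₁ (proj₂ isDirectedAnimalSeq)

  recurrence : ∀ m → RecurrenceStep m (A m) (A (suc m)) (A (suc (suc m)))
  recurrence = proj₂ (proj₂ isDirectedAnimalSeq)

  positive : ∀ n → 0 < A n
  positive 0 rewrite A₀≡1 = s≤s z≤n
  positive 1 rewrite A₁≡1 = s≤s z≤n
  positive (suc (suc m)) = positive-step {m} (recurrence m) (positive (suc m))

  ratioBounds : ∀ m → RatioLowerBound m (A m) (A (suc m)) × RatioUpperBound m (A m) (A (suc m))
  ratioBounds zero rewrite A₀≡1 | A₁≡1 = z≤n , s≤s (s≤s (s≤s z≤n))
  ratioBounds (suc m) with ratioBounds m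
  ... | lower , upper =
    ratioLowerBound-step m (A m) (A (suc m)) (A (suc (suc m))) (recurrence m) upper ,
    ratioUpperBound-step m (A m) (A (suc m)) (A (suc (suc m))) (recurrence m) lower

corollary3p7 : (A : ℕ → ℕ) → IsDirectedAnimalSeq A → LogConvex A
corollary3p7 A H =
  positive ,
  λ m → log-convex-step m (A m) (A (suc m)) (A (suc (suc m))) (recurrence m) (proj₂ (ratioBounds m))
  where
  open DirectedAnimals A H
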